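{- Let $f$ be computed by $M$, $p$, $\prec$ in the circular model. Then the function $\overline{f}$ defined by $\overline{f}(x)=2^{p(|x|)}-f(x)$ can be computed in the circular model (i.e., $\overline{f}\in{\rm CLU\#P_{circular}}$).
   Context: Alphabet $\Sigma=\{0,1\}$; NPTM = nondeterministic polynomial-time Turing machine. For a polynomial $p$, an NPTM $M$ is $p$-balanced if on every input $x$ its computation paths correspond exactly to the guess strings in $\{0,1\}^{p(|x|)}$; paths are identified with guess strings. $\mathrm{acc}_M(x)$ is the set of accepting paths, $\#\mathrm{acc}_M(x)$ its size. For same-length strings, $a\prec_{\rm lex}b$ means $b$ is the immediate lexicographic successor of $a$; $\le_{\rm lex}$ is lexicographic order. $f:\Sigma^*\to\mathbb{N}$ is computed by $p,M,\prec$ in the circular model if $p$ is a polynomial, $M$ a $p$-balanced NPTM, $\prec$ a polynomial-time 3-argument predicate, and for every $x$ there is a bijection $h_x$ of $\Sigma^{p(|x|)}$ with: for $y,z\in\{0,1\}^{p(|x|)}$, $\prec(x,y,z)$ iff $h_x(y)\prec_{\rm lex}h_x(z)$ or ($h_x(y)=1^{p(|x|)}$ and $h_x(z)=0^{p(|x|)}$); if $f(x)\neq0$ there exist $\ell,u\in\{0,1\}^{p(|x|)}$ with $\mathrm{acc}_M(x)=\{w: h_x(\ell)\le_{\rm lex}h_x(w)\le_{\rm lex}h_x(u)\}$; and $f(x)=\#\mathrm{acc}_M(x)$. ${\rm CLU\#P_{circular}}$ is the class of functions computed in the circular model by some $p,M,\prec$. -}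

module Defs where

open import Data.Nat using (ℕ; zero; suc; _+_; _*_; _^_; _∸_)
open import Data.Bool using (Bool; true; false)
open import Data.List using (List; []; _∷_; length; map; intercalate; filter)
open import Data.Vec using (Vec; []; _∷_; replicate; toList)
open import Data.Fin using (Fin; _≟_)
open import Data.Product using (Σ; _×_; _,_; ∃; ∃-syntax)
open import Data.Sum using (_⊎_)
open import Relation.Nullary using (¬_)
open import Relation.Nullary.Decidable using (⌊_⌋)
open import Relation.Binary.PropositionalEquality using (_≡_; _≢_)
open import Function.Bundles using (_⤖_; _⇔_; Bijection)

-- Polynomials with natural-number coefficients (constant term first)

Poly : Set
Poly = List ℕ

evalPoly : Poly → ℕ → ℕ
evalPoly []       n = 0
evalPoly (c ∷ cs) n = c + n * evalPoly cs n

-- Deterministic single-tape Turing machines (two-way infinite tape)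
-- over the tape alphabet {blank, 0, 1, #}

data Sym : Set where
  blank b0 b1 sep : Sym

data Move : Set where
  L R S : Move

record TM : Set where
  field
    nQ    : ℕ
    start : Fin nQ
    acc   : Fin nQ
    rej   : Fin nQ
    δ     : Fin nQ → Sym → Fin nQ × Sym × Move

record Config (M : TM) : Set where
  constructor cfg
  field
    state : Fin (TM.nQ M)
    left  : List Sym      -- cells left of the head, nearest first
    head  : Sym
    right : List Sym      -- cells right of the head, nearest first

open Config public

moveHead : Move → List Sym → Sym → List Sym → List Sym × Sym × List Sym
moveHead L []      h r = [] , blank , h ∷ r
moveHead L (a ∷ l) h r = l , a , h ∷ r
moveHead R l h []      = h ∷ l , blank , []
moveHead R l h (a ∷ r) = h ∷ l , a , r
moveHead S l h r = l , h , r

isHalting : (M : TM) → Fin (TM.nQ M) → Bool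
isHalting M q with ⌊ q ≟ TM.acc M ⌋ | ⌊ q ≟ TM.rej M ⌋
... | false | false = false
... | _     | _     = true

step : (M : TM) → Config M → Config M
step M c with isHalting M (state c)
... | true  = c
... | false with TM.δ M (state c) (head c)
...   | (q' , a , m) with moveHead m (left c) a (right c)
...     | (l' , h' , r') = cfg q' l' h' r'

run : (M : TM) → ℕ → Config M → Config M
run M zero    c = c
run M (suc n) c = run M n (step M c)

bitSym : Bool → Sym
bitSym false = b0
bitSym true  = b1

encode : List (List Bool) → List Sym
encode ws = intercalate (sep ∷ []) (map (map bitSym) ws)

initCfg : (M : TM) → List Sym → Config M
initCfg M []      = cfg (TM.start M) [] blank []
initCfg M (a ∷ w) = cfg (TM.start M) [] a w

finalCfg : (M : TM) → Poly → List (List Bool) → Config M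
finalCfg M t ws = run M (evalPoly t (length (encode ws))) (initCfg M (encode ws))

HaltsWithin : TM → Poly → List (List Bool) → Set
HaltsWithin M t ws = isHalting M (state (finalCfg M t ws)) ≡ true

acceptsWithin : TM → Poly → List (List Bool) → Bool
acceptsWithin M t ws = ⌊ state (finalCfg M t ws) ≟ TM.acc M ⌋

-- p-balanced NPTMs, presented as a deterministic polynomial-time machine V
-- reading the input x and the guess string (= computation path) y ∈ {0,1}^p(|x|)

Str : ℕ → Set
Str n = Vec Bool n

IsBalancedNPTM : Poly → TM → Poly → Set
IsBalancedNPTM p V tV = ∀ (x : List Bool) (y : Str (evalPoly p (length x))) →
  HaltsWithin V tV (x ∷ toList y ∷ [])

AccPath : (p : Poly) → TM → Poly → (x : List Bool) → Str (evalPoly p (length x)) → Set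
AccPath p V tV x y = acceptsWithin V tV (x ∷ toList y ∷ []) ≡ true

allStr : (n : ℕ) → List (Str n)
allStr zero    = [] ∷ []
allStr (suc n) = Data.List.map (false ∷_) (allStr n) Data.List.++ Data.List.map (true ∷_) (allStr n)

numAcc : (p : Poly) → TM → Poly → List Bool → ℕ
numAcc p V tV x =
  length (filter (λ y → Data.Bool._≟_ (acceptsWithin V tV (x ∷ toList y ∷ [])) true)
                 (allStr (evalPoly p (length x))))

IsPolyTimePred3 : TM → Poly → Set
IsPolyTimePred3 P tP = ∀ (x y z : List Bool) → HaltsWithin P tP (x ∷ y ∷ z ∷ [])

Holds3 : TM → Poly → List Bool → List Bool → List Bool → Set
Holds3 P tP x y z = acceptsWithin P tP (x ∷ y ∷ z ∷ []) ≡ true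

data _≤lex_ : {n : ℕ} → Str n → Str n → Set where
  []≤   : [] ≤lex []
  0<1   : ∀ {n} {a b : Str n} → (false ∷ a) ≤lex (true ∷ b)
  same  : ∀ {n} {c} {a b : Str n} → a ≤lex b → (c ∷ a) ≤lex (c ∷ b)

_<lex_ : {n : ℕ} → Str n → Str n → Set
a <lex b = (a ≤lex b) × (a ≢ b)

_≺lex_ : {n : ℕ} → Str n → Str n → Set
_≺lex_ {n} a b = (a <lex b) × (∀ (c : Str n) → ¬ ((a <lex c) × (c <lex b)))

ComputedCircular : (List Bool → ℕ) → Poly → TM → Poly → TM → Poly → Set
ComputedCircular f p V tV P tP =
  IsBalancedNPTM p V tV × IsPolyTimePred3 P tP ×
  (∀ (x : List Bool) →
    Σ (Str (evalPoly p (length x)) ⤖ Str (evalPoly p (length x))) λ hb →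
    let h = Bijection.to hb
        m = evalPoly p (length x) in
    (∀ (y z : Str m) →
       Holds3 P tP x (toList y) (toList z) ⇔
       ((h y ≺lex h z) ⊎ ((h y ≡ replicate m true) × (h z ≡ replicate m false))))
    × (f x ≢ 0 → ∃[ l ] ∃[ u ] (∀ (w : Str m) →
         AccPath p V tV x w ⇔ ((h l ≤lex h w) × (h w ≤lex h u))))
    × (f x ≡ numAcc p V tV x))

CLUSharpPcircular : (List Bool → ℕ) → Set
CLUSharpPcircular f = ∃[ p ] ∃[ V ] ∃[ tV ] ∃[ P ] ∃[ tP ] ComputedCircular f p V tV P tP

{-# OPTIONS --safe #-}
-- Read the values of the bijection h of the circular model as binary numbers.  The
-- accepting paths of V are those w with h w in an interval [Lo, Up], so after exchanging
-- the accepting and rejecting states of V the accepting paths are those with h w in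
-- [0, Lo) ∪ (Up, 2ᵐ).  Composing h with the rotation v ↦ v + (2ᵐ − 1 − Up) mod 2ᵐ turns
-- this set into the initial segment [0, Lo + 2ᵐ − 1 − Up); a rotation preserves the
-- cyclic successor relation, so the same predicate ≺ still describes the new order.
module Submission where

open import Defs
open import Data.Nat using (ℕ; zero; suc; _≟_; _+_; _^_; _∸_; _≤_; _<_; _≤?_; _<?_; z≤n; s≤s; s≤s⁻¹; NonZero)
open import Data.Nat.Properties
open import Data.Nat.DivMod using (_%_; %-distribˡ-+; m%n%n≡m%n; m%n<n; m<n⇒m%n≡m; n%n≡0; [m+n]%n≡m%n)
open import Data.Bool using (Bool; true; false; not; if_then_else_)
open import Data.Bool.Properties using (if-float) renaming (_≟_ to _≟ᵇ_)
open import Data.List using (List; []; _∷_; length; filter; map; _++_)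
open import Data.List.Properties using (length-++; length-map)
open import Data.List.Membership.Propositional using (_∈_)
open import Data.List.Membership.Propositional.Properties using (∈-filter⁺; ∈-filter⁻; ∈-map⁺; ∈-++⁺ˡ; ∈-++⁺ʳ)
open import Data.List.Relation.Unary.Any using (here)
open import Data.Vec using ([]; _∷_; replicate; toList)
open import Data.Fin using (zero; suc) renaming (_≟_ to _≟ᶠ_)
open import Data.Product using (_×_; _,_; proj₁; proj₂; ∃-syntax; Σ-syntax)
open import Data.Sum using (_⊎_; inj₁; inj₂)
open import Relation.Nullary using (¬_; yes; no; contradiction)
open import Relation.Nullary.Decidable using (⌊_⌋)
open import Relation.Unary using (Decidable)
open import Relation.Binary.PropositionalEquality
open import Function using (_∘_)
open import Function.Bundles using (_⤖_; _⇔_; mk⇔; mk↔ₛ′; Bijection; Equivalence)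
open import Function.Properties.Inverse using (↔⇒⤖)
open import Function.Construct.Identity using (⇔-id)
open import Function.Construct.Symmetry using (⇔-sym)
open import Function.Construct.Composition using (_⇔-∘_; _⤖-∘_)
open import Function.Related.TypeIsomorphisms using (¬-cong-⇔)
open import Data.Product.Function.NonDependent.Propositional using (_×-⇔_)

value : ∀ {n} → Str n → ℕ
value []                = 0
value {suc n} (b ∷ v) = (if b then 2 ^ n else 0) + value v

2^[1+n]≡2^n+2^n : ∀ n → 2 ^ suc n ≡ 2 ^ n + 2 ^ n
2^[1+n]≡2^n+2^n n = cong (2 ^ n +_) (+-identityʳ (2 ^ n))

value<2^n : ∀ {n} (v : Str n) → value v < 2 ^ n
value<2^n [] = s≤s z≤n
value<2^n {suc n} (true ∷ v) rewrite 2^[1+n]≡2^n+2^n n = +-monoʳ-< (2 ^ n) (value<2^n v)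
value<2^n {suc n} (false ∷ v) rewrite 2^[1+n]≡2^n+2^n n = ≤-trans (value<2^n v) (m≤m+n (2 ^ n) (2 ^ n))

fromValue : ∀ n → ℕ → Str n
fromValue zero    k = []
fromValue (suc n) k with 2 ^ n ≤? k
... | yes _ = true ∷ fromValue n (k ∸ 2 ^ n)
... | no _  = false ∷ fromValue n k

fromValue-value : ∀ {n} (v : Str n) → fromValue n (value v) ≡ v
fromValue-value [] = refl
fromValue-value {suc n} (true ∷ v) with 2 ^ n ≤? 2 ^ n + value v
... | yes _     = cong (true ∷_) (trans (cong (fromValue n) (m+n∸m≡n (2 ^ n) (value v))) (fromValue-value v))
... | no 2^n≰ = contradiction (m≤m+n (2 ^ n) (value v)) 2^n≰
fromValue-value {suc n} (false ∷ v) with 2 ^ n ≤? value v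
... | yes 2^n≤ = contradiction 2^n≤ (<⇒≱ (value<2^n v))
... | no _      = cong (false ∷_) (fromValue-value v)

value-fromValue : ∀ n {k} → k < 2 ^ n → value (fromValue n k) ≡ k
value-fromValue zero    {zero} _ = refl
value-fromValue zero    {suc k} (s≤s ())
value-fromValue (suc n) {k} k< with 2 ^ n ≤? k
... | no 2^n≰k = value-fromValue n (≰⇒> 2^n≰k)
... | yes 2^n≤k = trans (cong (2 ^ n +_) (value-fromValue n k∸2^n<)) (m+[n∸m]≡n 2^n≤k)
  where
    k∸2^n< : k ∸ 2 ^ n < 2 ^ n
    k∸2^n< = +-cancelˡ-< (2 ^ n) _ _
      (subst₂ _<_ (sym (m+[n∸m]≡n 2^n≤k)) (2^[1+n]≡2^n+2^n n) k<)

value-injective : ∀ {n} {a b : Str n} → value a ≡ value b → a ≡ b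
value-injective {n} {a} {b} eq =
  trans (sym (fromValue-value a)) (trans (cong (fromValue n) eq) (fromValue-value b))

≤lex⇒value≤ : ∀ {n} {a b : Str n} → a ≤lex b → value a ≤ value b
≤lex⇒value≤ []≤ = z≤n
≤lex⇒value≤ {suc n} (0<1 {a = a} {b}) = ≤-trans (<⇒≤ (value<2^n a)) (m≤m+n (2 ^ n) (value b))
≤lex⇒value≤ {suc n} (same {c = c} a≤b) = +-monoʳ-≤ (if c then 2 ^ n else 0) (≤lex⇒value≤ a≤b)

value≤⇒≤lex : ∀ {n} (a b : Str n) → value a ≤ value b → a ≤lex b
value≤⇒≤lex [] [] _ = []≤
value≤⇒≤lex (false ∷ a) (false ∷ b) a≤b = same (value≤⇒≤lex a b a≤b)
value≤⇒≤lex (false ∷ a) (true ∷ b)  _   = 0<1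
value≤⇒≤lex {suc n} (true ∷ a) (true ∷ b) a≤b = same (value≤⇒≤lex a b (+-cancelˡ-≤ (2 ^ n) _ _ a≤b))
value≤⇒≤lex {suc n} (true ∷ a) (false ∷ b) a≤b =
  contradiction (≤-trans (m≤m+n (2 ^ n) (value a)) a≤b) (<⇒≱ (value<2^n b))

≤lex⇔value≤ : ∀ {n} {a b : Str n} → a ≤lex b ⇔ value a ≤ value b
≤lex⇔value≤ = mk⇔ ≤lex⇒value≤ (value≤⇒≤lex _ _)

<lex⇔value< : ∀ {n} {a b : Str n} → a <lex b ⇔ value a < value b
<lex⇔value< {a = a} {b} = mk⇔
  (λ (a≤b , a≢b) → ≤∧≢⇒< (≤lex⇒value≤ a≤b) (a≢b ∘ value-injective))
  (λ a<b → value≤⇒≤lex a b (<⇒≤ a<b) , <⇒≢ a<b ∘ cong value)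

≺lex⇔suc-value≡ : ∀ {n} {a b : Str n} → a ≺lex b ⇔ suc (value a) ≡ value b
≺lex⇔suc-value≡ {n} {a} {b} = mk⇔ to from
  where
    to : a ≺lex b → suc (value a) ≡ value b
    to (a<b , nothing-between) with suc (value a) ≟ value b
    ... | yes eq = eq
    ... | no neq = contradiction (a< , <b) (nothing-between c)
      where
        a<b′ : value a < value b
        a<b′ = Equivalence.to <lex⇔value< a<b
        c : Str n
        c = fromValue n (suc (value a))
        value-c : value c ≡ suc (value a)
        value-c = value-fromValue n (≤-<-trans a<b′ (value<2^n b))
        a< : a <lex c
        a< = Equivalence.from <lex⇔value< (≤-reflexive (sym value-c))
        <b : c <lex b
        <b = Equivalence.from <lex⇔value< (subst (_< value b) (sym value-c) (≤∧≢⇒< a<b′ neq))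
    from : suc (value a) ≡ value b → a ≺lex b
    from eq = Equivalence.from <lex⇔value< (≤-reflexive eq) , λ c (a<c , c<b) →
      <⇒≱ (subst (value c <_) (sym eq) (Equivalence.to <lex⇔value< c<b)) (Equivalence.to <lex⇔value< a<c)

value-replicate-false : ∀ n → value (replicate n false) ≡ 0
value-replicate-false zero    = refl
value-replicate-false (suc n) = value-replicate-false n

suc-value-replicate-true : ∀ n → suc (value (replicate n true)) ≡ 2 ^ n
suc-value-replicate-true zero    = refl
suc-value-replicate-true (suc n) = begin
  suc (2 ^ n + value (replicate n true)) ≡⟨ +-suc (2 ^ n) _ ⟨
  2 ^ n + suc (value (replicate n true)) ≡⟨ cong (2 ^ n +_) (suc-value-replicate-true n) ⟩
  2 ^ n + 2 ^ n                          ≡⟨ 2^[1+n]≡2^n+2^n n ⟨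
  2 ^ suc n                              ∎
  where open ≡-Reasoning

[m%n+k]%n≡[m+k]%n : ∀ m k n .{{_ : NonZero n}} → (m % n + k) % n ≡ (m + k) % n
[m%n+k]%n≡[m+k]%n m k n = begin
  (m % n + k) % n           ≡⟨ %-distribˡ-+ (m % n) k n ⟩
  (m % n % n + k % n) % n   ≡⟨ cong (λ t → (t + k % n) % n) (m%n%n≡m%n m n) ⟩
  (m % n + k % n) % n       ≡⟨ %-distribˡ-+ m k n ⟨
  (m + k) % n               ∎
  where open ≡-Reasoning

[1+m%n]%n≡[1+m]%n : ∀ m n .{{_ : NonZero n}} → suc (m % n) % n ≡ suc m % n
[1+m%n]%n≡[1+m]%n m n = begin
  suc (m % n) % n   ≡⟨ cong (_% n) (+-comm 1 (m % n)) ⟩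
  (m % n + 1) % n   ≡⟨ [m%n+k]%n≡[m+k]%n m 1 n ⟩
  (m + 1) % n       ≡⟨ cong (_% n) (+-comm m 1) ⟩
  suc m % n         ∎
  where open ≡-Reasoning

_≺cyc_ : ∀ {n} → Str n → Str n → Set
_≺cyc_ {n} a b = (a ≺lex b) ⊎ ((a ≡ replicate n true) × (b ≡ replicate n false))

module _ {n : ℕ} where

  instance
    2^n≢0 : NonZero (2 ^ n)
    2^n≢0 = m^n≢0 2 n

  ≺cyc⇔suc-value%≡ : {a b : Str n} → a ≺cyc b ⇔ suc (value a) % 2 ^ n ≡ value b
  ≺cyc⇔suc-value%≡ {a} {b} = mk⇔ to from
    where
      2^n%2^n≡value0ⁿ : 2 ^ n % 2 ^ n ≡ value (replicate n false)
      2^n%2^n≡value0ⁿ = trans (n%n≡0 (2 ^ n)) (sym (value-replicate-false n))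

      to : a ≺cyc b → suc (value a) % 2 ^ n ≡ value b
      to (inj₁ a≺b) = trans (m<n⇒m%n≡m (subst (_< 2 ^ n) (sym eq) (value<2^n b))) eq
        where
          eq : suc (value a) ≡ value b
          eq = Equivalence.to ≺lex⇔suc-value≡ a≺b
      to (inj₂ (refl , refl)) = trans (cong (_% 2 ^ n) (suc-value-replicate-true n)) 2^n%2^n≡value0ⁿ

      from : suc (value a) % 2 ^ n ≡ value b → a ≺cyc b
      from eq with suc (value a) <? 2 ^ n
      ... | yes a+1<2^n = inj₁ (Equivalence.from ≺lex⇔suc-value≡ (trans (sym (m<n⇒m%n≡m a+1<2^n)) eq))
      ... | no a+1≮2^n = inj₂ (a≡1ⁿ , b≡0ⁿ)
        where
          a+1≡2^n : suc (value a) ≡ 2 ^ n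
          a+1≡2^n = ≤-antisym (value<2^n a) (≮⇒≥ a+1≮2^n)
          a≡1ⁿ : a ≡ replicate n true
          a≡1ⁿ = value-injective (suc-injective (trans a+1≡2^n (sym (suc-value-replicate-true n))))
          b≡0ⁿ : b ≡ replicate n false
          b≡0ⁿ = value-injective (trans (sym eq) (trans (cong (_% 2 ^ n) a+1≡2^n) 2^n%2^n≡value0ⁿ))

  rotate : ℕ → Str n → Str n
  rotate k v = fromValue n ((value v + k) % 2 ^ n)

  value-rotate : ∀ k (v : Str n) → value (rotate k v) ≡ (value v + k) % 2 ^ n
  value-rotate k v = value-fromValue n (m%n<n (value v + k) (2 ^ n))

  rotate-inverse : ∀ j k → j + k ≡ 2 ^ n → (v : Str n) → rotate j (rotate k v) ≡ v
  rotate-inverse j k j+k≡2^n v = value-injective (begin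
    value (rotate j (rotate k v))        ≡⟨ value-rotate j (rotate k v) ⟩
    (value (rotate k v) + j) % 2 ^ n     ≡⟨ cong (λ t → (t + j) % 2 ^ n) (value-rotate k v) ⟩
    ((value v + k) % 2 ^ n + j) % 2 ^ n  ≡⟨ [m%n+k]%n≡[m+k]%n (value v + k) j (2 ^ n) ⟩
    (value v + k + j) % 2 ^ n            ≡⟨ cong (_% 2 ^ n) (+-assoc (value v) k j) ⟩
    (value v + (k + j)) % 2 ^ n          ≡⟨ cong (λ t → (value v + t) % 2 ^ n) (trans (+-comm k j) j+k≡2^n) ⟩
    (value v + 2 ^ n) % 2 ^ n            ≡⟨ [m+n]%n≡m%n (value v) (2 ^ n) ⟩
    value v % 2 ^ n                      ≡⟨ m<n⇒m%n≡m (value<2^n v) ⟩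
    value v                              ∎)
    where open ≡-Reasoning

  rotate-≺cyc : ∀ k {a b : Str n} → a ≺cyc b → rotate k a ≺cyc rotate k b
  rotate-≺cyc k {a} {b} a≺b = Equivalence.from ≺cyc⇔suc-value%≡ (begin
    suc (value (rotate k a)) % 2 ^ n     ≡⟨ cong (λ t → suc t % 2 ^ n) (value-rotate k a) ⟩
    suc ((value a + k) % 2 ^ n) % 2 ^ n  ≡⟨ [1+m%n]%n≡[1+m]%n (value a + k) (2 ^ n) ⟩
    (suc (value a) + k) % 2 ^ n          ≡⟨ [m%n+k]%n≡[m+k]%n (suc (value a)) k (2 ^ n) ⟨
    (suc (value a) % 2 ^ n + k) % 2 ^ n  ≡⟨ cong (λ t → (t + k) % 2 ^ n) (Equivalence.to ≺cyc⇔suc-value%≡ a≺b) ⟩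
    (value b + k) % 2 ^ n                ≡⟨ value-rotate k b ⟨
    value (rotate k b)                   ∎)
    where open ≡-Reasoning

  module _ k (k≤2^n : k ≤ 2 ^ n) where

    private
      rotate-back : ∀ (v : Str n) → rotate (2 ^ n ∸ k) (rotate k v) ≡ v
      rotate-back = rotate-inverse (2 ^ n ∸ k) k (m∸n+n≡m k≤2^n)

    rotation : Str n ⤖ Str n
    rotation = ↔⇒⤖ (mk↔ₛ′ (rotate k) (rotate (2 ^ n ∸ k))
      (rotate-inverse k (2 ^ n ∸ k) (m+[n∸m]≡n k≤2^n)) rotate-back)

    ≺cyc⇔rotate-≺cyc : ∀ {a b : Str n} → a ≺cyc b ⇔ rotate k a ≺cyc rotate k b
    ≺cyc⇔rotate-≺cyc {a} {b} = mk⇔ (rotate-≺cyc k)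
      (λ ra≺rb → subst₂ _≺cyc_ (rotate-back a) (rotate-back b) (rotate-≺cyc (2 ^ n ∸ k) ra≺rb))

  -- Rotation by k sends (Up, 2ⁿ) onto [0, k) and [0, Lo) onto [k, Lo + k).
  rotate-below⇔outside : ∀ Lo Up k → suc Up + k ≡ 2 ^ n → (v : Str n) →
    value (rotate k v) < Lo + k ⇔ (¬ (Lo ≤ value v × value v ≤ Up))
  rotate-below⇔outside Lo Up k 1+Up+k≡2^n v with value v ≤? Up
  ... | yes v≤Up = mk⇔
    (λ rv< (Lo≤v , _) → <⇒≱ (+-cancelʳ-< k (value v) Lo (subst (_< Lo + k) rotate-v rv<)) Lo≤v)
    (λ v∉ → subst (_< Lo + k) (sym rotate-v) (+-monoˡ-< k (≰⇒> (λ Lo≤v → v∉ (Lo≤v , v≤Up)))))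
    where
      rotate-v : value (rotate k v) ≡ value v + k
      rotate-v = trans (value-rotate k v)
        (m<n⇒m%n≡m (subst (value v + k <_) 1+Up+k≡2^n (+-monoˡ-< k (s≤s v≤Up))))
  ... | no v≰Up = mk⇔
    (λ _ (_ , v≤Up) → v≰Up v≤Up)
    (λ _ → subst (_< Lo + k) (sym rotate-v) (≤-trans wrapped<k (m≤n+m k Lo)))
    where
      1+Up≤v : suc Up ≤ value v
      1+Up≤v = ≰⇒> v≰Up
      wrapped : ℕ
      wrapped = value v ∸ suc Up
      wrapped<k : wrapped < k
      wrapped<k = subst (wrapped <_) (trans (cong (_∸ suc Up) (sym 1+Up+k≡2^n)) (m+n∸m≡n (suc Up) k))
        (∸-monoˡ-< (value<2^n v) 1+Up≤v)
      v+k≡wrapped+2^n : value v + k ≡ wrapped + 2 ^ n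
      v+k≡wrapped+2^n = begin
        value v + k                    ≡⟨ cong (_+ k) (m∸n+n≡m 1+Up≤v) ⟨
        wrapped + suc Up + k           ≡⟨ +-assoc wrapped (suc Up) k ⟩
        wrapped + (suc Up + k)         ≡⟨ cong (wrapped +_) 1+Up+k≡2^n ⟩
        wrapped + 2 ^ n                ∎
        where open ≡-Reasoning
      rotate-v : value (rotate k v) ≡ wrapped
      rotate-v = begin
        value (rotate k v)             ≡⟨ value-rotate k v ⟩
        (value v + k) % 2 ^ n          ≡⟨ cong (_% 2 ^ n) v+k≡wrapped+2^n ⟩
        (wrapped + 2 ^ n) % 2 ^ n      ≡⟨ [m+n]%n≡m%n wrapped (2 ^ n) ⟩
        wrapped % 2 ^ n                ≡⟨ m<n⇒m%n≡m (≤-<-trans (m∸n≤m (value v) (suc Up)) (value<2^n v)) ⟩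
        wrapped                        ∎
        where open ≡-Reasoning

IsInterval : ∀ {n} → (Str n → Str n) → (Str n → Set) → Set
IsInterval h P = ∃[ l ] ∃[ u ] (∀ w → P w ⇔ ((h l ≤lex h w) × (h w ≤lex h u)))

SameCyclicOrder : ∀ {n} → (Str n → Str n) → (Str n → Str n) → Set
SameCyclicOrder {n} h h′ = ∀ (y z : Str n) → (h y ≺cyc h z) ⇔ (h′ y ≺cyc h′ z)

preimage-of-value : ∀ {n} (hb : Str n ⤖ Str n) {k} → k < 2 ^ n → ∃[ w ] value (Bijection.to hb w) ≡ k
preimage-of-value {n} hb {k} k< with Bijection.strictlySurjective hb (fromValue n k)
... | w , to-w≡ = w , trans (cong value to-w≡) (value-fromValue n k<)

prefix-isInterval : ∀ {n} (hb : Str n ⤖ Str n) {P : Str n → Set} B → 0 < B → B ≤ 2 ^ n →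
  (∀ w → P w ⇔ value (Bijection.to hb w) < B) → IsInterval (Bijection.to hb) P
prefix-isInterval hb (suc B) _ 1+B≤2^n P⇔
  with preimage-of-value hb (≤-<-trans z≤n 1+B≤2^n) | preimage-of-value hb 1+B≤2^n
... | l , value-l≡0 | u , value-u≡B = l , u , λ w → mk⇔
  (λ Pw → value≤⇒≤lex _ _ (subst (_≤ _) (sym value-l≡0) z≤n) ,
          value≤⇒≤lex _ _ (subst (_ ≤_) (sym value-u≡B) (s≤s⁻¹ (Equivalence.to (P⇔ w) Pw))))
  (λ (_ , w≤u) → Equivalence.from (P⇔ w) (s≤s (subst (_ ≤_) value-u≡B (≤lex⇒value≤ w≤u))))

complement-isInterval : ∀ {n} (hb : Str n ⤖ Str n) {P P′ : Str n → Set} →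
  (∀ w → P′ w ⇔ (¬ P w)) →
  (∀ w → ¬ P w) ⊎ ((∃[ w ] P w) × IsInterval (Bijection.to hb) P) →
  Σ[ hb′ ∈ Str n ⤖ Str n ]
    SameCyclicOrder (Bijection.to hb) (Bijection.to hb′) ×
    (∃[ w ] P′ w → IsInterval (Bijection.to hb′) P′)
complement-isInterval {n} hb P′⇔ (inj₁ P-empty) =
  hb , (λ _ _ → ⇔-id _) , λ _ → prefix-isInterval hb (2 ^ n) (m^n>0 2 n) ≤-refl
    (λ w → mk⇔ (λ _ → value<2^n (Bijection.to hb w)) (λ _ → Equivalence.from (P′⇔ w) (P-empty w)))
complement-isInterval {n} hb {P} {P′} P′⇔ (inj₂ ((w₀ , Pw₀) , l , u , P⇔)) =
  hb′ , (λ _ _ → ≺cyc⇔rotate-≺cyc k k≤2^n) , P′-isInterval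
  where
    open Bijection hb using (to)
    Lo Up k : ℕ
    Lo = value (to l)
    Up = value (to u)
    k = 2 ^ n ∸ suc Up
    k≤2^n : k ≤ 2 ^ n
    k≤2^n = m∸n≤m (2 ^ n) (suc Up)
    hb′ : Str n ⤖ Str n
    hb′ = rotation k k≤2^n ⤖-∘ hb
    1+Up+k≡2^n : suc Up + k ≡ 2 ^ n
    1+Up+k≡2^n = m+[n∸m]≡n (value<2^n (to u))
    Lo≤Up : Lo ≤ Up
    Lo≤Up with Equivalence.to (P⇔ w₀) Pw₀
    ... | l≤w₀ , w₀≤u = ≤-trans (≤lex⇒value≤ l≤w₀) (≤lex⇒value≤ w₀≤u)
    P′⇔below : ∀ w → P′ w ⇔ value (rotate k (to w)) < Lo + k
    P′⇔below w = ⇔-sym (rotate-below⇔outside Lo Up k 1+Up+k≡2^n (to w))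
      ⇔-∘ (¬-cong-⇔ ((≤lex⇔value≤ ×-⇔ ≤lex⇔value≤) ⇔-∘ P⇔ w) ⇔-∘ P′⇔ w)
    Lo+k≤2^n : Lo + k ≤ 2 ^ n
    Lo+k≤2^n = ≤-trans (+-monoˡ-≤ k (≤-trans Lo≤Up (n≤1+n Up))) (≤-reflexive 1+Up+k≡2^n)
    P′-isInterval : ∃[ w ] P′ w → IsInterval (Bijection.to hb′) P′
    P′-isInterval (w₁ , P′w₁) = prefix-isInterval hb′ (Lo + k)
      (≤-<-trans z≤n (Equivalence.to (P′⇔below w₁) P′w₁)) Lo+k≤2^n P′⇔below

countTrue : ∀ {A : Set} → (A → Bool) → List A → ℕ
countTrue g xs = length (filter (λ y → g y ≟ᵇ true) xs)

countTrue-not : ∀ {A : Set} (g g′ : A → Bool) → (∀ y → g′ y ≡ not (g y)) →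
  ∀ xs → countTrue g′ xs + countTrue g xs ≡ length xs
countTrue-not g g′ g′≡not [] = refl
countTrue-not g g′ g′≡not (y ∷ ys) with g y | g′ y | g′≡not y | countTrue-not g g′ g′≡not ys
... | true  | false | refl | ih = trans (+-suc (countTrue g′ ys) (countTrue g ys)) (cong suc ih)
... | false | true  | refl | ih = cong suc ih

module _ {A : Set} {P : A → Set} (P? : Decidable P) where

  length-filter≢0⇒∃ : ∀ xs → length (filter P? xs) ≢ 0 → ∃[ y ] P y
  length-filter≢0⇒∃ xs len≢0 with filter P? xs in filter≡
  ... | []    = contradiction refl len≢0
  ... | y ∷ _ = y , proj₂ (∈-filter⁻ P? {xs = xs} (subst (y ∈_) (sym filter≡) (here refl)))

  length-filter≡0⇒¬ : ∀ {xs y} → length (filter P? xs) ≡ 0 → y ∈ xs → ¬ P y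
  length-filter≡0⇒¬ {xs} len≡0 y∈xs Py with filter P? xs | ∈-filter⁺ P? y∈xs Py
  length-filter≡0⇒¬ ()    y∈xs Py | _ ∷ _ | _
  length-filter≡0⇒¬ len≡0 y∈xs Py | []    | ()

∈-allStr : ∀ {m} (y : Str m) → y ∈ allStr m
∈-allStr [] = here refl
∈-allStr {suc m} (false ∷ y) = ∈-++⁺ˡ (∈-map⁺ (false ∷_) (∈-allStr y))
∈-allStr {suc m} (true ∷ y)  = ∈-++⁺ʳ (map (false ∷_) (allStr m)) (∈-map⁺ (true ∷_) (∈-allStr y))

length-allStr : ∀ m → length (allStr m) ≡ 2 ^ m
length-allStr zero    = refl
length-allStr (suc m) = begin
  length (map (false ∷_) (allStr m) ++ map (true ∷_) (allStr m))
    ≡⟨ length-++ (map (false ∷_) (allStr m)) ⟩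
  length (map (false ∷_) (allStr m)) + length (map (true ∷_) (allStr m))
    ≡⟨ cong₂ _+_ (length-map (false ∷_) (allStr m)) (length-map (true ∷_) (allStr m)) ⟩
  length (allStr m) + length (allStr m)
    ≡⟨ cong₂ _+_ (length-allStr m) (length-allStr m) ⟩
  2 ^ m + 2 ^ m
    ≡⟨ 2^[1+n]≡2^n+2^n m ⟨
  2 ^ suc m ∎
  where open ≡-Reasoning

Complements : TM → TM → Poly → Set
Complements V V′ t = ∀ ws → HaltsWithin V t ws →
  HaltsWithin V′ t ws × (acceptsWithin V′ t ws ≡ not (acceptsWithin V t ws))

advance : (M : TM) → Config M → Config M
advance M (cfg q l h r) with TM.δ M q h
... | q′ , a , m with moveHead m l a r
...   | l′ , h′ , r′ = cfg q′ l′ h′ r′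

step≡ : ∀ M c → step M c ≡ (if isHalting M (state c) then c else advance M c)
step≡ M (cfg q l h r) with isHalting M q
... | true  = refl
... | false = refl

swapAccRej : TM → TM
swapAccRej V = record V { acc = TM.rej V ; rej = TM.acc V }

module _ (V : TM) where

  private
    V′ : TM
    V′ = swapAccRej V

  cast : Config V → Config V′
  cast (cfg q l h r) = cfg q l h r

  isHalting-swap : ∀ q → isHalting V′ q ≡ isHalting V q
  isHalting-swap q with q ≟ᶠ TM.acc V | q ≟ᶠ TM.rej V
  ... | yes _ | yes _ = refl
  ... | yes _ | no _  = refl
  ... | no _  | yes _ = refl
  ... | no _  | no _  = refl

  advance-swap : ∀ c → advance V′ (cast c) ≡ cast (advance V c)
  advance-swap (cfg q l h r) with TM.δ V q h
  ... | q′ , a , m with moveHead m l a r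
  ...   | l′ , h′ , r′ = refl

  step-swap : ∀ c → step V′ (cast c) ≡ cast (step V c)
  step-swap c = begin
    step V′ (cast c)
      ≡⟨ step≡ V′ (cast c) ⟩
    (if isHalting V′ (state c) then cast c else advance V′ (cast c))
      ≡⟨ cong (λ b → if b then cast c else advance V′ (cast c)) (isHalting-swap (state c)) ⟩
    (if isHalting V (state c) then cast c else advance V′ (cast c))
      ≡⟨ cong (if isHalting V (state c) then cast c else_) (advance-swap c) ⟩
    (if isHalting V (state c) then cast c else cast (advance V c))
      ≡⟨ if-float cast (isHalting V (state c)) ⟨
    cast (if isHalting V (state c) then c else advance V c)
      ≡⟨ cong cast (step≡ V c) ⟨
    cast (step V c) ∎
    where open ≡-Reasoning

  run-swap : ∀ t c → run V′ t (cast c) ≡ cast (run V t c)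
  run-swap zero    c = refl
  run-swap (suc t) c = trans (cong (run V′ t) (step-swap c)) (run-swap t (step V c))

  initCfg-swap : ∀ w → initCfg V′ w ≡ cast (initCfg V w)
  initCfg-swap []      = refl
  initCfg-swap (a ∷ w) = refl

  finalState-swap : ∀ t ws → state (finalCfg V′ t ws) ≡ state (finalCfg V t ws)
  finalState-swap t ws = cong state (trans (cong (run V′ steps) (initCfg-swap (encode ws)))
                                           (run-swap steps (initCfg V (encode ws))))
    where
      steps : ℕ
      steps = evalPoly t (length (encode ws))

  verdict-swap : ∀ q → TM.acc V ≢ TM.rej V → isHalting V q ≡ true →
    ⌊ q ≟ᶠ TM.rej V ⌋ ≡ not ⌊ q ≟ᶠ TM.acc V ⌋
  verdict-swap q acc≢rej halts with q ≟ᶠ TM.acc V | q ≟ᶠ TM.rej V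
  ... | yes refl | yes q≡rej = contradiction q≡rej acc≢rej
  ... | yes _    | no _      = refl
  ... | no _     | yes _     = refl
  ... | no _     | no _      = contradiction halts λ ()

  swapAccRej-complements : TM.acc V ≢ TM.rej V → ∀ t → Complements V V′ t
  swapAccRej-complements acc≢rej t ws halts =
    trans (cong (isHalting V′) (finalState-swap t ws)) (trans (isHalting-swap _) halts) ,
    trans (cong (λ q → ⌊ q ≟ᶠ TM.rej V ⌋) (finalState-swap t ws)) (verdict-swap _ acc≢rej halts)

rejectAll : TM
rejectAll = record { nQ = 2 ; start = suc zero ; acc = zero ; rej = suc zero ; δ = λ _ _ → suc zero , blank , S }

run-rejectAll : ∀ s l h r → run rejectAll s (cfg (suc zero) l h r) ≡ cfg (suc zero) l h r
run-rejectAll zero    l h r = refl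
run-rejectAll (suc s) l h r = run-rejectAll s l h r

finalState-rejectAll : ∀ t ws → state (finalCfg rejectAll t ws) ≡ suc zero
finalState-rejectAll t ws with encode ws
... | []    = cong state (run-rejectAll (evalPoly t 0) [] blank [])
... | a ∷ w = cong state (run-rejectAll (evalPoly t (suc (length w))) [] a w)

halting-accepts : ∀ (V : TM) q → TM.acc V ≡ TM.rej V → isHalting V q ≡ true →
  ⌊ q ≟ᶠ TM.acc V ⌋ ≡ true
halting-accepts V q acc≡rej halts with q ≟ᶠ TM.acc V | q ≟ᶠ TM.rej V
... | yes _     | _         = refl
... | no q≢acc  | yes q≡rej = contradiction (trans q≡rej (sym acc≡rej)) q≢acc
... | no _      | no _      = contradiction halts λ ()

rejectAll-complements : ∀ {V} → TM.acc V ≡ TM.rej V → ∀ t → Complements V rejectAll t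
rejectAll-complements {V} acc≡rej t ws halts =
  cong (isHalting rejectAll) (finalState-rejectAll t ws) ,
  trans (cong (λ q → ⌊ q ≟ᶠ zero ⌋) (finalState-rejectAll t ws))
        (cong not (sym (halting-accepts V _ acc≡rej halts)))

-- If acc ≡ rej then every halting run accepts and exchanging the two states changes
-- nothing; the complement is then the machine that rejects at once.
complementMachine : ∀ V t → Σ[ V′ ∈ TM ] Complements V V′ t
complementMachine V t with TM.acc V ≟ᶠ TM.rej V
... | yes acc≡rej = rejectAll , rejectAll-complements acc≡rej t
... | no acc≢rej  = swapAccRej V , swapAccRej-complements V acc≢rej t

not≡true⇔≢true : ∀ b → (not b ≡ true) ⇔ (b ≢ true)
not≡true⇔≢true true  = mk⇔ (λ ()) (λ b≢true → contradiction refl b≢true)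
not≡true⇔≢true false = mk⇔ (λ _ ()) (λ _ → refl)

complementCount-isInterval : ∀ {m} (hb : Str m ⤖ Str m) (acc acc′ : Str m → Bool) F →
  (∀ w → acc′ w ≡ not (acc w)) →
  (F ≢ 0 → IsInterval (Bijection.to hb) (λ w → acc w ≡ true)) →
  F ≡ countTrue acc (allStr m) →
  Σ[ hb′ ∈ Str m ⤖ Str m ] SameCyclicOrder (Bijection.to hb) (Bijection.to hb′) ×
    (2 ^ m ∸ F ≢ 0 → IsInterval (Bijection.to hb′) (λ w → acc′ w ≡ true)) ×
    (2 ^ m ∸ F ≡ countTrue acc′ (allStr m))
complementCount-isInterval {m} hb acc acc′ F acc′≡not interval F≡count
  with complement-isInterval hb acc′⇔not empty-or-interval
  where
    acc′⇔not : ∀ w → (acc′ w ≡ true) ⇔ (acc w ≢ true)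
    acc′⇔not w =
      subst (λ b → (b ≡ true) ⇔ (acc w ≢ true)) (sym (acc′≡not w)) (not≡true⇔≢true (acc w))
    empty-or-interval : (∀ w → acc w ≢ true) ⊎
                        ((∃[ w ] acc w ≡ true) × IsInterval (Bijection.to hb) (λ w → acc w ≡ true))
    empty-or-interval with F ≟ 0
    ... | yes F≡0 = inj₁ λ w → length-filter≡0⇒¬ _ (trans (sym F≡count) F≡0) (∈-allStr w)
    ... | no F≢0  = inj₂ (length-filter≢0⇒∃ _ (allStr m) (F≢0 ∘ trans F≡count) , interval F≢0)
... | hb′ , same-order , interval′ = hb′ , same-order , interval′ ∘ nonempty , F′≡count
  where
    c c′ : ℕ
    c = countTrue acc (allStr m)
    c′ = countTrue acc′ (allStr m)
    c′+c≡2^m : c′ + c ≡ 2 ^ m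
    c′+c≡2^m = trans (countTrue-not acc acc′ acc′≡not (allStr m)) (length-allStr m)
    F′≡count : 2 ^ m ∸ F ≡ c′
    F′≡count = begin
      2 ^ m ∸ F                   ≡⟨ cong₂ _∸_ (sym c′+c≡2^m) F≡count ⟩
      c′ + c ∸ c                  ≡⟨ m+n∸n≡m c′ c ⟩
      c′                          ∎
      where open ≡-Reasoning
    nonempty : 2 ^ m ∸ F ≢ 0 → ∃[ w ] acc′ w ≡ true
    nonempty F′≢0 = length-filter≢0⇒∃ _ (allStr m) (F′≢0 ∘ trans F′≡count)

complement-computedCircular : ∀ f p V tV P tP V′ → Complements V V′ tV →
  ComputedCircular f p V tV P tP →
  ComputedCircular (λ x → 2 ^ evalPoly p (length x) ∸ f x) p V′ tV P tP
complement-computedCircular f p V tV P tP V′ V′-complements (balanced , P-polytime , circular) =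
  (λ x y → proj₁ (V′-complements (x ∷ toList y ∷ []) (balanced x y))) , P-polytime , λ x →
    let hb , ≺⇔≺cyc , interval , f≡count = circular x
        complemented w = proj₂ (V′-complements (x ∷ toList w ∷ []) (balanced x w))
        hb′ , same-order , interval′ , f′≡count =
          complementCount-isInterval hb _ _ (f x) complemented interval f≡count
    in hb′ , (λ y z → same-order y z ⇔-∘ ≺⇔≺cyc y z) , interval′ , f′≡count

proposition5p6 : (f : List Bool → ℕ) (p : Poly) (V : TM) (tV : Poly) (P : TM) (tP : Poly) →
    ComputedCircular f p V tV P tP →
    CLUSharpPcircular (λ x → 2 ^ evalPoly p (length x) ∸ f x)
proposition5p6 f p V tV P tP computed with complementMachine V tV
... | V′ , V′-complements =
  p , V′ , tV , P , tP , complement-computedCircular f p V tV P tP V′ V′-complements computed
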